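{- For every integer $k\geq 1$, $\left\vert\mathsf{APS}^+_{2k}\setminus \mathsf{APS}_{2k}\right\vert =2^{2k-1} - \binom{2k}{k}$.
   Context: For $n\in\mathbb{N}$, $[n]=\{1,\dots,n\}$ and $\pm[n]=[n]\cup -[n]$. $\mathfrak{S}_n$ is the symmetric group of bijections of $[n]$, and $\mathfrak{S}_n^B$ is the group of signed permutations, i.e. bijections $w:\pm[n]\to\pm[n]$ with $w(-i)=-w(i)$, written in one-line notation $w(1)\cdots w(n)$ (so $\mathfrak{S}_n\subseteq\mathfrak{S}_n^B$). A pinnacle of $w$ is a value $w(i)$ with $2\le i\le n-1$ and $w(i-1)<w(i)>w(i+1)$; the pinnacle set of $w$ is the set of its pinnacles. $\mathsf{APS}_n$ is the set of pinnacle sets of elements of $\mathfrak{S}_n$, $\mathsf{APS}^B_n$ is the set of pinnacle sets of elements of $\mathfrak{S}_n^B$, and $\mathsf{APS}^+_n=\{S\in\mathsf{APS}^B_n : S\subset\mathbb{N}\}$, where $\mathbb{N}=\{1,2,3,\dots\}$. -}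

module Defs where

open import Data.Nat using (ℕ; suc; _≤_)
open import Data.Integer using (ℤ; +_; ∣_∣; _<_)
open import Data.Fin using (Fin; toℕ)
open import Data.Fin.Subset using (Subset; _∈_)
open import Data.Product using (Σ; ∃; _×_)
open import Relation.Binary.PropositionalEquality using (_≡_)
open import Function.Bundles using (_⇔_)
open import Relation.Nullary using (¬_)

-- A word of length n in one-line notation: position i (0-based Fin n,
-- i.e. paper position toℕ i + 1) holds the value w i.
Word : ℕ → Set
Word n = Fin n → ℤ

-- w is a signed permutation of [n] (one-line notation w(1)…w(n)):
-- every |w(i)| lies in [n] and the absolute values are pairwise distinct.
-- (Such data determine exactly one bijection of ±[n] with w(-i) = -w(i).)
IsSignedPerm : (n : ℕ) → Word n → Set
IsSignedPerm n w =
  (∀ i → 1 ≤ ∣ w i ∣ × ∣ w i ∣ ≤ n) × (∀ i j → ∣ w i ∣ ≡ ∣ w j ∣ → i ≡ j)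

IsPerm : (n : ℕ) → Word n → Set
IsPerm n w = IsSignedPerm n w × (∀ i → + 0 < w i)

IsPinnacle : {n : ℕ} → Word n → ℤ → Set
IsPinnacle {n} w m =
  Σ (Fin n) λ i → Σ (Fin n) λ j → Σ (Fin n) λ l →
    (toℕ j ≡ suc (toℕ i)) × (toℕ l ≡ suc (toℕ j)) ×
    (w i < w j) × (w l < w j) × (w j ≡ m)

-- A subset S of Fin n encodes the set of positive integers
-- { toℕ x + 1 | x ∈ S } ⊆ [n].
Encodes : {n : ℕ} → Subset n → ℤ → Set
Encodes {n} S m = Σ (Fin n) λ x → (x ∈ S) × (m ≡ + suc (toℕ x))

HasPinnacleSet : {n : ℕ} → Word n → Subset n → Set
HasPinnacleSet w S = ∀ m → IsPinnacle w m ⇔ Encodes S m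

InAPS : (n : ℕ) → Subset n → Set
InAPS n S = Σ (Word n) λ w → IsPerm n w × HasPinnacleSet w S

-- S ∈ APS⁺_n  (a positive pinnacle set of a signed permutation; any
-- positive pinnacle value is ≤ n, so such S is a subset of [n]).
InAPS⁺ : (n : ℕ) → Subset n → Set
InAPS⁺ n S = Σ (Word n) λ w → IsSignedPerm n w × HasPinnacleSet w S

InDiff : (n : ℕ) → Subset n → Set
InDiff n S = InAPS⁺ n S × ¬ InAPS n S

{-# OPTIONS --safe #-}
-- For n ≥ 1 a set S ⊆ [n] is the pinnacle set of a signed permutation iff 2|S| < n, and of a
-- permutation iff 2|S ∩ [m]| < m for all m ≥ 1 (a ballot condition). Necessity: a pinnacle ≤ m
-- has both neighbours below it and pinnacles are never adjacent, so p pinnacles ≤ m force at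
-- least 2p + 1 entries ≤ m, and a permutation has at most m of them. Sufficiency: alternate the
-- members of S, increasing, with the non-members, either negated and decreasing or (using the
-- ballot condition) increasing. For n = 2k, complementation shows that 2^(2k-1) - C(2k,k)/2
-- subsets satisfy 2|S| < 2k, and the reflection principle that C(2k,k)/2 of them are ballot sets.
module Submission where

open import Defs
open import Level using (0ℓ)
open import Data.Empty using (⊥; ⊥-elim)
open import Function using (_∘_; _⇔_; mk⇔; Equivalence)
import Function.Properties.Equivalence as ⇔
open import Data.Unit using (⊤; tt)
open import Data.Bool using (true; false)
open import Data.Product using (Σ; _×_; _,_; proj₁; proj₂)
open import Data.Sum using (_⊎_; inj₁; inj₂)
open import Data.Nat
open import Data.Nat.Properties
open import Data.Integer as ℤ using (ℤ; +_; +<+; +≤+)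
import Data.Integer.Properties as ℤ
open import Data.Nat.Combinatorics using (_C_; nCk+nC[k+1]≡[n+1]C[k+1]; nCk≡nC[n∸k])
open import Data.Nat.Tactic.RingSolver using (solve-∀)
open import Data.Vec using ([]; _∷_; here; there)
open import Data.Fin using (Fin; zero; suc; toℕ)
import Data.Vec.Properties as Vec
open import Data.Fin.Subset using (Subset; inside; outside; ∣_∣)
import Data.Fin.Subset as Subset
open import Data.Fin.Subset.Properties using (∣p∣≤n)
open import Data.List using (List; []; _∷_; _++_; [_]; map; length; filter; tabulate; lookup)
open import Data.List.Properties
  using (length-++; length-++-sucʳ; length-map; length-tabulate; length-filter; filter-++; filter-≐; filter-none; filter-all; filter-accept;
         map-∘; map-cong; map-id; map-++; tabulate-lookup; ++-identityʳ; ++-assoc)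
open import Data.List.Membership.Propositional using (_∈_)
open import Data.List.Membership.Propositional.Properties
  using (∈-map⁺; ∈-map⁻; ∈-++⁺ˡ; ∈-++⁺ʳ; ∈-++⁻; ∈-∃++; ∈-lookup; ∈-filter⁺; ∈-filter⁻)
open import Data.List.Relation.Unary.Any using (here; there)
open import Data.List.Relation.Unary.All using (All; []; _∷_; universal)
import Data.List.Relation.Unary.All as All
import Data.List.Relation.Unary.All.Properties as All
open import Data.List.Relation.Unary.Linked using (Linked; []; [-]; _∷_)
import Data.List.Relation.Unary.Linked as Linked
import Data.List.Relation.Unary.Linked.Properties as Linked
open import Data.List.Relation.Unary.Linked.Properties using (Linked⇒AllPairs)
import Data.List.Relation.Unary.AllPairs as AllPairs
open import Data.List.Relation.Binary.Permutation.Propositional using (_↭_; prep; swap; ↭-refl; ↭-trans; ↭-sym; ↭-reflexive; ↭⇒↭ₛ)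
open import Data.List.Relation.Binary.Permutation.Propositional.Properties using (shift; ∈-resp-↭; ↭-length)
import Data.List.Relation.Binary.Permutation.Propositional.Properties as ↭
import Data.List.Relation.Binary.Permutation.Setoid.Properties as ↭ₛ
open import Data.List.Relation.Unary.AllPairs using ([]; _∷_)
open import Data.List.Relation.Unary.Unique.Propositional using (Unique)
import Data.List.Relation.Unary.Unique.Propositional.Properties as Unique
open import Relation.Nullary using (¬_; Dec; yes; no; does)
open import Relation.Nullary.Decidable using (_×-dec_)
open import Relation.Unary using (Pred; Decidable; _⊆_; _≐_; _∩_; ∁)
open import Relation.Unary.Properties using (_∩?_; ∁?)
open import Relation.Binary.PropositionalEquality hiding ([_])

private
  variable
    n : ℕ
    A B : Set

double : ℕ → ℕ
double zero    = zero
double (suc n) = suc (suc (double n))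

double≡+ : ∀ n → double n ≡ n + n
double≡+ zero    = refl
double≡+ (suc n) = cong suc (trans (cong suc (double≡+ n)) (sym (+-suc n n)))

double-mono-≤ : ∀ {m n} → m ≤ n → double m ≤ double n
double-mono-≤ z≤n       = z≤n
double-mono-≤ (s≤s m≤n) = s≤s (s≤s (double-mono-≤ m≤n))

double<2+double⇒≤ : ∀ m n → double m < 2 + double n → m ≤ n
double<2+double⇒≤ zero    n       _                 = z≤n
double<2+double⇒≤ (suc m) zero    (s≤s (s≤s ()))
double<2+double⇒≤ (suc m) (suc n) (s≤s (s≤s lt)) = s≤s (double<2+double⇒≤ m n lt)

2+m<n⇒m<n∸2 : ∀ {m n} → 2 + m < n → m < n ∸ 2
2+m<n⇒m<n∸2 {n = suc (suc n)} (s≤s (s≤s lt)) = lt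

m<n∸2⇒2+m<n : ∀ {m n} → m < n ∸ 2 → 2 + m < n
m<n∸2⇒2+m<n {n = suc (suc n)} lt = s≤s (s≤s lt)

subsets : (n : ℕ) → List (Subset n)
subsets zero    = [ [] ]
subsets (suc n) = map (inside ∷_) (subsets n) ++ map (outside ∷_) (subsets n)

∈-subsets : (S : Subset n) → S ∈ subsets n
∈-subsets []            = here refl
∈-subsets (inside ∷ S)  = ∈-++⁺ˡ (∈-map⁺ (inside ∷_) (∈-subsets S))
∈-subsets (outside ∷ S) = ∈-++⁺ʳ _ (∈-map⁺ (outside ∷_) (∈-subsets S))

subsets-unique : ∀ n → Unique (subsets n)
subsets-unique zero    = [] ∷ []
subsets-unique (suc n) =
  Unique.++⁺ (Unique.map⁺ Vec.∷-injectiveʳ (subsets-unique n))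
             (Unique.map⁺ Vec.∷-injectiveʳ (subsets-unique n)) disjoint
  where
  disjoint : ∀ {S} → S ∈ map (inside ∷_) (subsets n) × S ∈ map (outside ∷_) (subsets n) → ⊥
  disjoint (S∈ins , S∈outs) with ∈-map⁻ (inside ∷_) S∈ins | ∈-map⁻ (outside ∷_) S∈outs
  ... | _ , _ , refl | _ , _ , ()

length-subsets : ∀ n → length (subsets n) ≡ 2 ^ n
length-subsets zero    = refl
length-subsets (suc n) = begin
  length (map (inside ∷_) (subsets n) ++ map (outside ∷_) (subsets n))
    ≡⟨ length-++ (map (inside ∷_) (subsets n)) ⟩
  length (map (inside ∷_) (subsets n)) + length (map (outside ∷_) (subsets n))
    ≡⟨ cong₂ _+_ (length-map _ (subsets n)) (length-map _ (subsets n)) ⟩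
  length (subsets n) + length (subsets n)
    ≡⟨ cong₂ _+_ (length-subsets n) (trans (length-subsets n) (sym (+-identityʳ _))) ⟩
  2 ^ suc n ∎
  where open ≡-Reasoning

length-filter-map : {P : Pred B 0ℓ} (P? : Decidable P) (f : A → B) (xs : List A) →
                    length (filter P? (map f xs)) ≡ length (filter (P? ∘ f) xs)
length-filter-map P? f []       = refl
length-filter-map P? f (x ∷ xs) with does (P? (f x))
... | true  = cong suc (length-filter-map P? f xs)
... | false = length-filter-map P? f xs

length-filter-∖ : {P Q : Pred A 0ℓ} (P? : Decidable P) (Q? : Decidable Q) → Q ⊆ P → (xs : List A) →
                  length (filter (P? ∩? ∁? Q?) xs) + length (filter Q? xs) ≡ length (filter P? xs)
length-filter-∖ P? Q? Q⊆P []       = refl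
length-filter-∖ P? Q? Q⊆P (x ∷ xs) with P? x | Q? x
... | yes _ | yes _  = trans (+-suc _ _) (cong suc (length-filter-∖ P? Q? Q⊆P xs))
... | yes _ | no  _  = cong suc (length-filter-∖ P? Q? Q⊆P xs)
... | no ¬p | yes q  = ⊥-elim (¬p (Q⊆P q))
... | no  _ | no  _  = length-filter-∖ P? Q? Q⊆P xs

#subsets : {P : Pred (Subset n) 0ℓ} → Decidable P → ℕ
#subsets {n} P? = length (filter P? (subsets n))

module _ {P : Pred (Subset n) 0ℓ} (P? : Decidable P) where

  #subsets-none : (∀ S → ¬ P S) → #subsets P? ≡ 0
  #subsets-none ¬P = cong length (filter-none P? (universal ¬P (subsets n)))

  #subsets-all : (∀ S → P S) → #subsets P? ≡ 2 ^ n
  #subsets-all allP = trans (cong length (filter-all P? (universal allP (subsets n)))) (length-subsets n)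

  #subsets-cong : {Q : Pred (Subset n) 0ℓ} (Q? : Decidable Q) → P ≐ Q → #subsets P? ≡ #subsets Q?
  #subsets-cong Q? P≐Q = cong length (filter-≐ P? Q? P≐Q (subsets n))

  #subsets-∖ : {Q : Pred (Subset n) 0ℓ} (Q? : Decidable Q) → Q ⊆ P →
               #subsets (P? ∩? ∁? Q?) + #subsets Q? ≡ #subsets P?
  #subsets-∖ Q? Q⊆P = length-filter-∖ P? Q? Q⊆P (subsets n)

#subsets-suc : {P : Pred (Subset (suc n)) 0ℓ} (P? : Decidable P) →
               #subsets P? ≡ #subsets (P? ∘ (inside ∷_)) + #subsets (P? ∘ (outside ∷_))
#subsets-suc {n} P? = begin
  length (filter P? (map (inside ∷_) (subsets n) ++ map (outside ∷_) (subsets n)))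
    ≡⟨ cong length (filter-++ P? (map (inside ∷_) (subsets n)) _) ⟩
  length (filter P? (map (inside ∷_) (subsets n)) ++ filter P? (map (outside ∷_) (subsets n)))
    ≡⟨ length-++ (filter P? (map (inside ∷_) (subsets n))) ⟩
  length (filter P? (map (inside ∷_) (subsets n))) + length (filter P? (map (outside ∷_) (subsets n)))
    ≡⟨ cong₂ _+_ (length-filter-map P? _ (subsets n)) (length-filter-map P? _ (subsets n)) ⟩
  #subsets (P? ∘ (inside ∷_)) + #subsets (P? ∘ (outside ∷_)) ∎
  where open ≡-Reasoning

Small : ℕ → Pred (Subset n) 0ℓ
Small a S = double ∣ S ∣ < a

Small? : ∀ a → Decidable (Small {n} a)
Small? a S = double ∣ S ∣ <? a

#small : ℕ → ℕ → ℕ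
#small n a = #subsets (Small? {n} a)

#small-suc : ∀ n a → #small (suc n) a ≡ #small n (a ∸ 2) + #small n a
#small-suc n a = trans (#subsets-suc {n} (Small? a))
  (cong (_+ #small n a) (#subsets-cong {n} (Small? a ∘ (inside ∷_)) (Small? (a ∸ 2)) (2+m<n⇒m<n∸2 , m<n∸2⇒2+m<n)))

#small-zero : ∀ n → #small n 0 ≡ 0
#small-zero n = #subsets-none (Small? {n} 0) λ _ ()

#small-full : ∀ n a → double n < a → #small n a ≡ 2 ^ n
#small-full n a 2n<a = #subsets-all (Small? {n} a) λ S → ≤-<-trans (double-mono-≤ (∣p∣≤n S)) 2n<a

#small-complement : ∀ n a b → a + b ≡ suc (double n) → #small n a + #small n b ≡ 2 ^ n
#small-complement zero zero          (suc zero) _  = refl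
#small-complement zero (suc zero)    zero       _  = refl
#small-complement zero zero          (suc (suc b)) ()
#small-complement zero (suc zero)    (suc b)    ()
#small-complement zero (suc (suc a)) b          ()
#small-complement (suc n) a b a+b≡ = begin
  #small (suc n) a + #small (suc n) b
    ≡⟨ cong₂ _+_ (#small-suc n a) (#small-suc n b) ⟩
  (#small n (a ∸ 2) + #small n a) + (#small n (b ∸ 2) + #small n b)
    ≡⟨ regroup (#small n (a ∸ 2)) (#small n a) (#small n (b ∸ 2)) (#small n b) ⟩
  (#small n a + #small n (b ∸ 2)) + (#small n b + #small n (a ∸ 2))
    ≡⟨ cong₂ _+_ (shifted a b a+b≡) (shifted b a (trans (+-comm b a) a+b≡)) ⟩
  2 ^ n + 2 ^ n
    ≡⟨ cong (_+_ (2 ^ n)) (sym (+-identityʳ (2 ^ n))) ⟩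
  2 ^ suc n ∎
  where
  open ≡-Reasoning
  regroup : ∀ w x y z → (w + x) + (y + z) ≡ (x + y) + (z + w)
  regroup = solve-∀
  full : ∀ {a} → 2 + double n ≤ a → #small n a + #small n 0 ≡ 2 ^ n
  full {a} 2+2n≤a = trans (cong₂ _+_ (#small-full n a (≤-trans (n≤1+n _) 2+2n≤a)) (#small-zero n)) (+-identityʳ _)
  shifted : ∀ a b → a + b ≡ suc (double (suc n)) → #small n a + #small n (b ∸ 2) ≡ 2 ^ n
  shifted a (suc (suc b)) a+b≡ = #small-complement n a b
    (suc-injective (suc-injective (trans (sym (trans (+-suc a (suc b)) (cong suc (+-suc a b)))) a+b≡)))
  shifted a zero       a+0≡ = full (≤-trans (n≤1+n _) (≤-reflexive (trans (sym a+0≡) (+-identityʳ a))))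
  shifted a (suc zero) a+1≡ = full (≤-reflexive (suc-injective (trans (sym a+1≡) (+-comm a 1))))

#small-parity : ∀ n i → #small n (2 + double i) ≡ #small n (suc (double i))
#small-parity n i = #subsets-cong {n} (Small? _) (Small? _)
  ((λ {S} lt → s≤s (double-mono-≤ (double<2+double⇒≤ ∣ S ∣ i lt))) , m≤n⇒m≤1+n)

#small-odd : ∀ n i → #small n (suc (double i)) ≡ #small n (double i) + n C i
#small-odd zero    zero    = refl
#small-odd zero    (suc i) = refl
#small-odd (suc n) zero    = begin
  #small (suc n) 1           ≡⟨ #small-suc n 1 ⟩
  #small n 0 + #small n 1    ≡⟨ cong₂ _+_ (#small-zero n) (#small-odd n 0) ⟩
  #small n 0 + 1             ≡⟨ cong (_+ 1) (trans (#small-zero n) (sym (#small-zero (suc n)))) ⟩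
  #small (suc n) 0 + 1       ∎
  where open ≡-Reasoning
#small-odd (suc n) (suc i) = begin
  #small (suc n) (3 + double i)
    ≡⟨ #small-suc n _ ⟩
  #small n (suc (double i)) + #small n (suc (double (suc i)))
    ≡⟨ cong₂ _+_ (#small-odd n i) (#small-odd n (suc i)) ⟩
  (#small n (double i) + n C i) + (#small n (2 + double i) + n C suc i)
    ≡⟨ regroup (#small n (double i)) (n C i) (#small n (2 + double i)) (n C suc i) ⟩
  (#small n (double i) + #small n (2 + double i)) + (n C i + n C suc i)
    ≡⟨ cong₂ _+_ (sym (#small-suc n _)) (nCk+nC[k+1]≡[n+1]C[k+1] n i) ⟩
  #small (suc n) (2 + double i) + suc n C suc i ∎
  where
  open ≡-Reasoning
  regroup : ∀ a b c d → (a + b) + (c + d) ≡ (a + c) + (b + d)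
  regroup = solve-∀

-- Ballot sequences

-- Ballot 0 S says that 2|S ∩ [m]| < m for every m ∈ S; the counter h is the surplus of
-- non-members over members read so far.
Ballot : ℕ → Subset n → Set
Ballot h []            = ⊤
Ballot h (outside ∷ S) = Ballot (suc h) S
Ballot h (inside ∷ S)  = 2 ≤ h × Ballot (pred h) S

Ballot? : ∀ h → Decidable (Ballot {n} h)
Ballot? h []            = yes tt
Ballot? h (outside ∷ S) = Ballot? (suc h) S
Ballot? h (inside ∷ S)  = (2 ≤? h) ×-dec Ballot? (pred h) S

#ballot : ℕ → ℕ → ℕ
#ballot n h = #subsets (Ballot? {n} h)

#ballot-suc-0 : ∀ n → #ballot (suc n) 0 ≡ #ballot n 1
#ballot-suc-0 n = trans (#subsets-suc {n} (Ballot? 0))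
  (cong (_+ #ballot n 1) (#subsets-none {n} (Ballot? 0 ∘ (inside ∷_)) λ { _ (() , _) }))

#ballot-suc-1 : ∀ n → #ballot (suc n) 1 ≡ #ballot n 2
#ballot-suc-1 n = trans (#subsets-suc {n} (Ballot? 1))
  (cong (_+ #ballot n 2) (#subsets-none {n} (Ballot? 1 ∘ (inside ∷_)) λ { _ (s≤s () , _) }))

#ballot-suc-2+ : ∀ n h → #ballot (suc n) (2 + h) ≡ #ballot n (suc h) + #ballot n (3 + h)
#ballot-suc-2+ n h = trans (#subsets-suc {n} (Ballot? (2 + h)))
  (cong (_+ #ballot n (3 + h)) (#subsets-cong {n} (Ballot? (2 + h) ∘ (inside ∷_)) (Ballot? (suc h))
    (proj₂ , (s≤s (s≤s z≤n) ,_))))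

Ballot⇒Small : ∀ h (S : Subset n) → Ballot h S → 1 ≤ h + n → Small (h + n) S
Ballot⇒Small h                 []            _         1≤h = 1≤h
Ballot⇒Small {suc n} h         (outside ∷ S) ballot    _   =
  subst (λ a → Small a S) (sym (+-suc h n)) (Ballot⇒Small (suc h) S ballot (s≤s z≤n))
Ballot⇒Small {suc n} (suc (suc h)) (inside ∷ S) (_ , ballot) _ =
  s≤s (s≤s (subst (λ a → Small a S) (sym (+-suc h n)) (Ballot⇒Small (suc h) S ballot (s≤s z≤n))))
Ballot⇒Small (suc zero) (inside ∷ S) (s≤s () , _) _

-- The reflection principle, in the form of an identity between counts.
#ballot-reflection : ∀ n h → #ballot n (suc h) + #small n (n ∸ suc h) ≡ #small n (n + suc h)
#ballot-reflection zero    h       = refl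
#ballot-reflection (suc n) zero    = begin
  #ballot (suc n) 1 + #small (suc n) n
    ≡⟨ cong₂ _+_ (#ballot-suc-1 n) (#small-suc n n) ⟩
  #ballot n 2 + (#small n (n ∸ 2) + #small n n)
    ≡⟨ sym (+-assoc (#ballot n 2) _ _) ⟩
  (#ballot n 2 + #small n (n ∸ 2)) + #small n n
    ≡⟨ cong (_+ #small n n) (#ballot-reflection n 1) ⟩
  #small n (n + 2) + #small n n
    ≡⟨ +-comm (#small n (n + 2)) _ ⟩
  #small n n + #small n (n + 2)
    ≡⟨ cong (λ a → #small n a + #small n (n + 2)) (sym (m+n∸n≡m n 2)) ⟩
  #small n (n + 2 ∸ 2) + #small n (n + 2)
    ≡⟨ sym (#small-suc n (n + 2)) ⟩
  #small (suc n) (n + 2)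
    ≡⟨ cong (#small (suc n)) (+-suc n 1) ⟩
  #small (suc n) (suc n + 1) ∎
  where open ≡-Reasoning
#ballot-reflection (suc n) (suc h) = begin
  #ballot (suc n) (2 + h) + #small (suc n) (n ∸ suc h)
    ≡⟨ cong₂ _+_ (#ballot-suc-2+ n h) (#small-suc n (n ∸ suc h)) ⟩
  (#ballot n (suc h) + #ballot n (3 + h)) + (#small n (n ∸ suc h ∸ 2) + #small n (n ∸ suc h))
    ≡⟨ cong (λ a → (#ballot n (suc h) + #ballot n (3 + h)) + (#small n a + #small n (n ∸ suc h)))
            (trans (∸-+-assoc n (suc h) 2) (cong (n ∸_) (+-comm (suc h) 2))) ⟩
  (#ballot n (suc h) + #ballot n (3 + h)) + (#small n (n ∸ (3 + h)) + #small n (n ∸ suc h))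
    ≡⟨ regroup (#ballot n (suc h)) (#ballot n (3 + h)) (#small n (n ∸ (3 + h))) (#small n (n ∸ suc h)) ⟩
  (#ballot n (suc h) + #small n (n ∸ suc h)) + (#ballot n (3 + h) + #small n (n ∸ (3 + h)))
    ≡⟨ cong₂ _+_ (#ballot-reflection n h) (#ballot-reflection n (2 + h)) ⟩
  #small n (n + suc h) + #small n (n + (3 + h))
    ≡⟨ cong₂ (λ a b → #small n a + #small n b) (sym (m+n∸n≡m (n + suc h) 2)) (move-suc n h) ⟩
  #small n (n + suc h + 2 ∸ 2) + #small n (n + suc h + 2)
    ≡⟨ sym (#small-suc n (n + suc h + 2)) ⟩
  #small (suc n) (n + suc h + 2)
    ≡⟨ cong (#small (suc n)) (move-suc′ n h) ⟩
  #small (suc n) (suc n + suc (suc h)) ∎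
  where
  open ≡-Reasoning
  regroup : ∀ a b c d → (a + b) + (c + d) ≡ (a + d) + (b + c)
  regroup = solve-∀
  move-suc : ∀ n h → n + (3 + h) ≡ n + suc h + 2
  move-suc = solve-∀
  move-suc′ : ∀ n h → n + suc h + 2 ≡ suc n + suc (suc h)
  move-suc′ = solve-∀

central-binomial : ∀ j → (2 + double j) C suc j ≡ (1 + double j) C j + (1 + double j) C j
central-binomial j = begin
  (2 + double j) C suc j      ≡⟨ sym (nCk+nC[k+1]≡[n+1]C[k+1] m j) ⟩
  m C j + m C suc j           ≡⟨ cong (_+_ (m C j)) (nCk≡nC[n∸k] (s≤s (≤-trans (m≤m+n j j) (≤-reflexive (sym (double≡+ j)))))) ⟩
  m C j + m C (double j ∸ j)  ≡⟨ cong (λ k → m C j + m C k) (trans (cong (_∸ j) (double≡+ j)) (m+n∸n≡m j j)) ⟩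
  m C j + m C j               ∎
  where
  open ≡-Reasoning
  m = suc (double j)

#small∖ballot : ∀ j → let N = double (suc j) in
                #subsets (Small? {N} N ∩? ∁? (Ballot? 0)) ≡ 2 ^ (N ∸ 1) ∸ N C suc j
#small∖ballot j = begin
  D                            ≡⟨ D≡X+X ⟩
  X + X                        ≡⟨ sym (m+n∸n≡m (X + X) (c + c)) ⟩
  (X + X) + (c + c) ∸ (c + c)  ≡⟨ cong₂ _∸_ X+X+c+c≡2^m (sym (central-binomial j)) ⟩
  2 ^ m ∸ N C suc j            ∎
  where
  open ≡-Reasoning
  m = suc (double j)
  N = suc m
  X = #small m (double j)
  c = m C j
  D = #subsets (Small? {N} N ∩? ∁? (Ballot? 0))
  X+ballot : X + #ballot N 0 ≡ #small m (2 + double j)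
  X+ballot = begin
    X + #ballot N 0                 ≡⟨ +-comm X _ ⟩
    #ballot N 0 + X                 ≡⟨ cong (_+ X) (#ballot-suc-0 m) ⟩
    #ballot m 1 + #small m (m ∸ 1)  ≡⟨ #ballot-reflection m 0 ⟩
    #small m (m + 1)                ≡⟨ cong (#small m) (+-comm m 1) ⟩
    #small m (2 + double j)         ∎
  D≡X+X : D ≡ X + X
  D≡X+X = +-cancelʳ-≡ (#ballot N 0) D (X + X) (begin
    D + #ballot N 0              ≡⟨ #subsets-∖ (Small? N) (Ballot? 0) (λ {S} b → Ballot⇒Small 0 S b (s≤s z≤n)) ⟩
    #small N N                   ≡⟨ #small-suc m N ⟩
    X + #small m (2 + double j)  ≡⟨ cong (_+_ X) (sym X+ballot) ⟩
    X + (X + #ballot N 0)        ≡⟨ sym (+-assoc X X _) ⟩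
    X + X + #ballot N 0          ∎)
  4j+3 : suc (double j) + (2 + double j) ≡ suc (double m)
  4j+3 = cong suc (trans (+-suc (double j) (suc (double j)))
                         (cong suc (trans (+-suc (double j) (double j)) (cong suc (sym (double≡+ (double j)))))))
  X+X+c+c≡2^m : (X + X) + (c + c) ≡ 2 ^ m
  X+X+c+c≡2^m = begin
    (X + X) + (c + c)  ≡⟨ regroup X c ⟩
    (X + c) + (X + c)  ≡⟨ cong₂ _+_ (sym (#small-odd m j)) (trans (sym (#small-odd m j)) (sym (#small-parity m j))) ⟩
    #small m (suc (double j)) + #small m (2 + double j) ≡⟨ #small-complement m _ _ 4j+3 ⟩
    2 ^ m              ∎
    where
    regroup : ∀ x y → (x + x) + (y + y) ≡ (x + y) + (x + y)
    regroup = solve-∀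

members : ℕ → Subset n → List ℕ
members o []            = []
members o (inside ∷ S)  = suc o ∷ members (suc o) S
members o (outside ∷ S) = members (suc o) S

nonMembers : ℕ → Subset n → List ℕ
nonMembers o []            = []
nonMembers o (inside ∷ S)  = nonMembers (suc o) S
nonMembers o (outside ∷ S) = suc o ∷ nonMembers (suc o) S

range : ℕ → ℕ → List ℕ
range o zero    = []
range o (suc n) = suc o ∷ range (suc o) n

∈-range⁻ : ∀ o n {x} → x ∈ range o n → o < x × x ≤ o + n
∈-range⁻ o (suc n) (here refl) = ≤-refl , ≤-trans (s≤s (m≤m+n o n)) (≤-reflexive (sym (+-suc o n)))
∈-range⁻ o (suc n) (there x∈) with ∈-range⁻ (suc o) n x∈
... | o<x , x≤ = <-trans (n<1+n o) o<x , ≤-trans x≤ (≤-reflexive (sym (+-suc o n)))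

∈-range⁺ : ∀ o n {x} → o < x → x ≤ o + n → x ∈ range o n
∈-range⁺ o zero    o<x x≤o+0 = ⊥-elim (<⇒≱ o<x (≤-trans x≤o+0 (≤-reflexive (+-identityʳ o))))
∈-range⁺ o (suc n) o<x x≤ with m≤n⇒m<n∨m≡n o<x
... | inj₂ refl = here refl
... | inj₁ 1+o<x = there (∈-range⁺ (suc o) n 1+o<x (≤-trans x≤ (≤-reflexive (+-suc o n))))

range-unique : ∀ o n → Unique (range o n)
range-unique o zero    = []
range-unique o (suc n) =
  All.tabulate (λ x∈ 1+o≡x → <-irrefl 1+o≡x (proj₁ (∈-range⁻ (suc o) n x∈))) ∷ range-unique (suc o) n

length-range : ∀ o n → length (range o n) ≡ n
length-range o zero    = refl
length-range o (suc n) = cong suc (length-range (suc o) n)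

All⇒Linked-∷ : ∀ {R : ℕ → ℕ → Set} {x xs} → All (R x) xs → Linked R xs → Linked R (x ∷ xs)
All⇒Linked-∷ []        []       = [-]
All⇒Linked-∷ (Rxy ∷ _) linked  = Rxy ∷ linked

↗⇒Unique : ∀ {xs} → Linked _<_ xs → Unique xs
↗⇒Unique = AllPairs.map <⇒≢ ∘ Linked⇒AllPairs <-trans

members-above : ∀ o (S : Subset n) → All (o <_) (members o S)
members-above o []            = []
members-above o (inside ∷ S)  = n<1+n o ∷ All.map (<-trans (n<1+n o)) (members-above (suc o) S)
members-above o (outside ∷ S) = All.map (<-trans (n<1+n o)) (members-above (suc o) S)

nonMembers-above : ∀ o (S : Subset n) → All (o <_) (nonMembers o S)
nonMembers-above o []            = []
nonMembers-above o (inside ∷ S)  = All.map (<-trans (n<1+n o)) (nonMembers-above (suc o) S)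
nonMembers-above o (outside ∷ S) = n<1+n o ∷ All.map (<-trans (n<1+n o)) (nonMembers-above (suc o) S)

members-↗ : ∀ o (S : Subset n) → Linked _<_ (members o S)
members-↗ o []            = []
members-↗ o (inside ∷ S)  = All⇒Linked-∷ (members-above (suc o) S) (members-↗ (suc o) S)
members-↗ o (outside ∷ S) = members-↗ (suc o) S

nonMembers-↗ : ∀ o (S : Subset n) → Linked _<_ (nonMembers o S)
nonMembers-↗ o []            = []
nonMembers-↗ o (inside ∷ S)  = nonMembers-↗ (suc o) S
nonMembers-↗ o (outside ∷ S) = All⇒Linked-∷ (nonMembers-above (suc o) S) (nonMembers-↗ (suc o) S)

members++nonMembers↭range : ∀ o (S : Subset n) → members o S ++ nonMembers o S ↭ range o n
members++nonMembers↭range o []            = ↭-refl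
members++nonMembers↭range o (inside ∷ S)  = prep (suc o) (members++nonMembers↭range (suc o) S)
members++nonMembers↭range o (outside ∷ S) =
  ↭-trans (shift (suc o) (members (suc o) S) _) (prep (suc o) (members++nonMembers↭range (suc o) S))

length-members : ∀ o (S : Subset n) → length (members o S) ≡ ∣ S ∣
length-members o []            = refl
length-members o (inside ∷ S)  = cong suc (length-members (suc o) S)
length-members o (outside ∷ S) = length-members (suc o) S

members-complete : ∀ o {S : Subset n} {x} → x Subset.∈ S → suc (o + toℕ x) ∈ members o S
members-complete o {inside ∷ S}  here        = here (cong suc (+-identityʳ o))
members-complete o {inside ∷ S}  (there x∈S) =
  there (subst (_∈ members (suc o) S) (cong suc (sym (+-suc o _))) (members-complete (suc o) x∈S))
members-complete o {outside ∷ S} (there x∈S) =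
  subst (_∈ members (suc o) S) (cong suc (sym (+-suc o _))) (members-complete (suc o) x∈S)

members-sound : ∀ o (S : Subset n) {y} → y ∈ members o S → Σ (Fin n) λ x → x Subset.∈ S × y ≡ suc (o + toℕ x)
members-sound o (inside ∷ S)  (here refl) = zero , here , cong suc (sym (+-identityʳ o))
members-sound o (inside ∷ S)  (there y∈)  with members-sound (suc o) S y∈
... | x , x∈S , refl = suc x , there x∈S , cong suc (sym (+-suc o (toℕ x)))
members-sound o (outside ∷ S) y∈          with members-sound (suc o) S y∈
... | x , x∈S , refl = suc x , there x∈S , cong suc (sym (+-suc o (toℕ x)))

Encodes⇔∈members : (S : Subset n) (z : ℤ) → Encodes S z ⇔ z ∈ map +_ (members 0 S)
Encodes⇔∈members S z = mk⇔
  (λ { (x , x∈S , refl) → ∈-map⁺ +_ (members-complete 0 x∈S) })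
  (λ z∈ → let y , y∈ , z≡ = ∈-map⁻ +_ z∈ ; x , x∈S , y≡ = members-sound 0 S y∈
          in x , x∈S , trans z≡ (cong +_ y≡))

∣_↾_∣ : Subset n → ℕ → ℕ
∣ S             ↾ zero  ∣ = 0
∣ []            ↾ suc m ∣ = 0
∣ (inside ∷ S)  ↾ suc m ∣ = suc ∣ S ↾ m ∣
∣ (outside ∷ S) ↾ suc m ∣ = ∣ S ↾ m ∣

∣S↾n∣≡∣S∣ : (S : Subset n) → ∣ S ↾ n ∣ ≡ ∣ S ∣
∣S↾n∣≡∣S∣ []            = refl
∣S↾n∣≡∣S∣ (inside ∷ S)  = cong suc (∣S↾n∣≡∣S∣ S)
∣S↾n∣≡∣S∣ (outside ∷ S) = ∣S↾n∣≡∣S∣ S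

length-filter-members : ∀ o m (S : Subset n) → length (filter (_≤? o + m) (members o S)) ≡ ∣ S ↾ m ∣
length-filter-members o zero    S =
  cong length (filter-none (_≤? o + 0) (All.map (λ o<y y≤o+0 → <⇒≱ o<y (≤-trans y≤o+0 (≤-reflexive (+-identityʳ o))))
                                                (members-above o S)))
length-filter-members o (suc m) []            = refl
length-filter-members o (suc m) (inside ∷ S)  = begin
  length (filter (_≤? o + suc m) (suc o ∷ members (suc o) S))
    ≡⟨ cong length (filter-accept (_≤? o + suc m) (≤-trans (s≤s (m≤m+n o m)) (≤-reflexive (sym (+-suc o m))))) ⟩
  suc (length (filter (_≤? o + suc m) (members (suc o) S)))
    ≡⟨ cong (λ c → suc (length (filter (_≤? c) (members (suc o) S)))) (+-suc o m) ⟩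
  suc (length (filter (_≤? suc o + m) (members (suc o) S)))
    ≡⟨ cong suc (length-filter-members (suc o) m S) ⟩
  suc ∣ S ↾ m ∣ ∎
  where open ≡-Reasoning
length-filter-members o (suc m) (outside ∷ S) =
  trans (cong (λ c → length (filter (_≤? c) (members (suc o) S))) (+-suc o m)) (length-filter-members (suc o) m S)

prefix⇒Ballot : ∀ h (S : Subset n) → (∀ m → 1 ≤ m → double ∣ S ↾ m ∣ < h + m) → Ballot h S
prefix⇒Ballot h []            _     = tt
prefix⇒Ballot h (outside ∷ S) bound =
  prefix⇒Ballot (suc h) S λ m _ → subst (double ∣ S ↾ m ∣ <_) (+-suc h m) (bound (suc m) (s≤s z≤n))
prefix⇒Ballot (suc (suc h)) (inside ∷ S) bound = s≤s (s≤s z≤n) ,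
  prefix⇒Ballot (suc h) S λ m _ → subst (double ∣ S ↾ m ∣ <_) (+-suc h m) (≤-pred (≤-pred (bound (suc m) (s≤s z≤n))))
prefix⇒Ballot zero          (inside ∷ S) bound with bound 1 (s≤s z≤n)
... | s≤s ()
prefix⇒Ballot (suc zero)    (inside ∷ S) bound with bound 1 (s≤s z≤n)
... | s≤s (s≤s ())

-- Pinnacles of lists of integers

data Pinnacle : List ℤ → ℤ → Set where
  here  : ∀ {a b c l} → a ℤ.< b → c ℤ.< b → Pinnacle (a ∷ b ∷ c ∷ l) b
  there : ∀ {x l z} → Pinnacle l z → Pinnacle (x ∷ l) z

NoPinnacle : List ℤ → Set
NoPinnacle l = ∀ z → ¬ Pinnacle l z

↗⇒NoPinnacle : ∀ {l} → Linked ℤ._<_ l → NoPinnacle l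
↗⇒NoPinnacle (_ ∷ b<c ∷ _) _ (here _ c<b) = ℤ.<-asym b<c c<b
↗⇒NoPinnacle (_ ∷ l↗)      z (there pin)  = ↗⇒NoPinnacle l↗ z pin
↗⇒NoPinnacle [-]           _ (there ())

↘⇒NoPinnacle : ∀ {l} → Linked ℤ._>_ l → NoPinnacle l
↘⇒NoPinnacle (b<a ∷ _) _ (here a<b _) = ℤ.<-asym a<b b<a
↘⇒NoPinnacle (_ ∷ l↘)  z (there pin)  = ↘⇒NoPinnacle l↘ z pin
↘⇒NoPinnacle [-]       _ (there ())

alternate : List A → List A → List A
alternate []       ys = ys
alternate (x ∷ xs) ys = x ∷ alternate ys xs

zigzag : List ℤ → List ℤ → List ℤ
zigzag ps []       = []
zigzag ps (v ∷ vs) = v ∷ alternate ps vs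

data Zigzag : List ℤ → List ℤ → Set where
  flat : ∀ {v vs} → NoPinnacle (v ∷ vs) → Zigzag [] (v ∷ vs)
  peak : ∀ {p ps v v′ vs} → v ℤ.< p → v′ ℤ.< p → Zigzag ps (v′ ∷ vs) → Zigzag (p ∷ ps) (v ∷ v′ ∷ vs)

Pinnacle-after-peak : ∀ {p v l z} → v ℤ.< p → Pinnacle (p ∷ v ∷ l) z → Pinnacle (v ∷ l) z
Pinnacle-after-peak v<p (here p<v _) = ⊥-elim (ℤ.<-asym p<v v<p)
Pinnacle-after-peak v<p (there pin)  = pin

Pinnacle-zigzag⇔ : ∀ {ps vs} → Zigzag ps vs → ∀ z → Pinnacle (zigzag ps vs) z ⇔ z ∈ ps
Pinnacle-zigzag⇔ zz z = mk⇔ (sound zz) (complete zz)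
  where
  sound : ∀ {ps vs} → Zigzag ps vs → Pinnacle (zigzag ps vs) z → z ∈ ps
  sound (flat none)      pin        = ⊥-elim (none z pin)
  sound (peak _ _ _)     (here _ _) = here refl
  sound (peak _ v′<p zz) (there pin) = there (sound zz (Pinnacle-after-peak v′<p pin))
  complete : ∀ {ps vs} → Zigzag ps vs → z ∈ ps → Pinnacle (zigzag ps vs) z
  complete (peak v<p v′<p _) (here refl) = here v<p v′<p
  complete (peak _ _ zz)     (there z∈)  = there (there (complete zz z∈))

zigzag-↭ : ∀ {ps vs} → Zigzag ps vs → zigzag ps vs ↭ ps ++ vs
zigzag-↭ (flat _) = ↭-refl
zigzag-↭ (peak {p} {ps} {v} {v′} {vs} _ _ zz) =
  ↭-trans (prep v (prep p (zigzag-↭ zz)))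
    (↭-trans (swap v p ↭-refl) (prep p (↭-sym (shift v ps (v′ ∷ vs)))))

consIf : {P : Set} → Dec P → A → List A → List A
consIf (yes _) x xs = x ∷ xs
consIf (no  _) _ xs = xs

pinnacles : List ℤ → List ℤ
pinnacles (a ∷ l@(b ∷ c ∷ _)) = consIf (a ℤ.<? b ×-dec c ℤ.<? b) b (pinnacles l)
pinnacles _                   = []

∈-pinnacles⁺ : ∀ {l z} → Pinnacle l z → z ∈ pinnacles l
∈-pinnacles⁺ (here {a} {b} {c} a<b c<b) with a ℤ.<? b ×-dec c ℤ.<? b
... | yes _    = here refl
... | no ¬peak = ⊥-elim (¬peak (a<b , c<b))
∈-pinnacles⁺ {a ∷ b ∷ c ∷ _} (there pin) with a ℤ.<? b ×-dec c ℤ.<? b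
... | yes _ = there (∈-pinnacles⁺ pin)
... | no  _ = ∈-pinnacles⁺ pin
∈-pinnacles⁺ {_ ∷ _ ∷ []} (there (there ()))

pinnacles-descent : ∀ {b d} r → d ℤ.< b → pinnacles (b ∷ d ∷ r) ≡ pinnacles (d ∷ r)
pinnacles-descent []      _   = refl
pinnacles-descent {b} {d} (e ∷ r) d<b with b ℤ.<? d ×-dec e ℤ.<? d
... | yes (b<d , _) = ⊥-elim (ℤ.<-asym b<d d<b)
... | no  _         = refl

module _ (c : ℤ) where

  #≤ : List ℤ → ℕ
  #≤ l = length (filter (ℤ._≤? c) l)

  Sparse : ℕ → ℤ → List ℤ → Set
  Sparse P a l = double P ≤ #≤ l × (¬ a ℤ.≤ c → P ≡ 0 ⊎ double P < #≤ l)

  Sparse-∷ : ∀ {P} a b l → Sparse P b l → Sparse P a (b ∷ l)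
  Sparse-∷ a b l (2P≤ , ifAbove) with b ℤ.≤? c
  ... | yes _   = m≤n⇒m≤1+n 2P≤ , λ _ → inj₂ (s≤s 2P≤)
  ... | no  b≰c = 2P≤ , λ _ → ifAbove b≰c

  -- A pinnacle at most c has both neighbours below it, and two pinnacles are never adjacent.
  pinnacles-sparse : ∀ a l → Sparse (#≤ (pinnacles (a ∷ l))) a l
  pinnacles-sparse a []          = z≤n , λ _ → inj₁ refl
  pinnacles-sparse a (b ∷ [])    = z≤n , λ _ → inj₁ refl
  pinnacles-sparse a (b ∷ d ∷ r) = step (pinnacles-sparse b (d ∷ r)) (pinnacles-sparse d r)
    where
    step : Sparse (#≤ (pinnacles (b ∷ d ∷ r))) b (d ∷ r) → Sparse (#≤ (pinnacles (d ∷ r))) d r →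
           Sparse (#≤ (pinnacles (a ∷ b ∷ d ∷ r))) a (b ∷ d ∷ r)
    step ih ih₂ with a ℤ.<? b ×-dec d ℤ.<? b
    ... | no _ = Sparse-∷ a b (d ∷ r) ih
    ... | yes (a<b , d<b) with b ℤ.≤? c
    ...   | no b≰c = proj₁ ih , λ _ → proj₂ ih b≰c
    ...   | yes b≤c rewrite pinnacles-descent r d<b
                          | cong length (filter-accept (ℤ._≤? c) {xs = r} (ℤ.≤-trans (ℤ.<⇒≤ d<b) b≤c)) =
      s≤s (s≤s (proj₁ ih₂)) , λ a≰c → ⊥-elim (a≰c (ℤ.≤-trans (ℤ.<⇒≤ a<b) b≤c))

  pinnacles-bound : ∀ l → #≤ (pinnacles l) ≡ 0 ⊎ double (#≤ (pinnacles l)) < #≤ l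
  pinnacles-bound []      = inj₁ refl
  pinnacles-bound (a ∷ l) with a ℤ.≤? c
  ... | yes _   = inj₂ (s≤s (proj₁ (pinnacles-sparse a l)))
  ... | no  a≰c = proj₂ (pinnacles-sparse a l) a≰c

IsPinnacle⇒Pinnacle : (w : Word n) {z : ℤ} → IsPinnacle w z → Pinnacle (tabulate w) z
IsPinnacle⇒Pinnacle w (i , j , k , j≡1+i , k≡1+j , wi<wj , wk<wj , refl) = go w i j k j≡1+i k≡1+j wi<wj wk<wj
  where
  go : ∀ {n} (w : Word n) i j k → toℕ j ≡ suc (toℕ i) → toℕ k ≡ suc (toℕ j) →
       w i ℤ.< w j → w k ℤ.< w j → Pinnacle (tabulate w) (w j)
  go w zero    (suc zero) (suc (suc zero)) refl refl wi<wj wk<wj = here wi<wj wk<wj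
  go w (suc i) (suc j)    (suc k)          j≡   k≡   wi<wj wk<wj =
    there (go (w ∘ suc) i j k (suc-injective j≡) (suc-injective k≡) wi<wj wk<wj)
  go w zero    zero                 _                    ()   _
  go w zero    (suc (suc _))        _                    ()   _
  go w zero    (suc zero)           zero                 _    ()
  go w zero    (suc zero)           (suc zero)           _    ()
  go w zero    (suc zero)           (suc (suc (suc _)))  _    ()
  go w (suc _) zero                 _                    ()   _
  go w (suc _) (suc _)              zero                 _    ()

Pinnacle⇒IsPinnacle : (w : Word n) {z : ℤ} → Pinnacle (tabulate w) z → IsPinnacle w z
Pinnacle⇒IsPinnacle {suc (suc (suc n))} w (here wi<wj wk<wj) =
  zero , suc zero , suc (suc zero) , refl , refl , wi<wj , wk<wj , refl
Pinnacle⇒IsPinnacle {suc (suc (suc n))} w (there pin) with Pinnacle⇒IsPinnacle (w ∘ suc) pin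
... | i , j , k , j≡ , k≡ , wi<wj , wk<wj , wj≡z =
  suc i , suc j , suc k , cong suc j≡ , cong suc k≡ , wi<wj , wk<wj , wj≡z
Pinnacle⇒IsPinnacle {suc zero}       w (there ())
Pinnacle⇒IsPinnacle {suc (suc zero)} w (there (there ()))

IsPinnacle⇔Pinnacle : (w : Word n) (z : ℤ) → IsPinnacle w z ⇔ Pinnacle (tabulate w) z
IsPinnacle⇔Pinnacle w z = mk⇔ (IsPinnacle⇒Pinnacle w) (Pinnacle⇒IsPinnacle w)

lookup-injective : (f : A → B) (xs : List A) → Unique (map f xs) →
                   ∀ i j → f (lookup xs i) ≡ f (lookup xs j) → i ≡ j
lookup-injective f (x ∷ xs) _                zero    zero    _  = refl
lookup-injective f (x ∷ xs) (fx∉ ∷ _)        zero    (suc j) eq = ⊥-elim (All.lookup fx∉ (∈-map⁺ f (∈-lookup j)) eq)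
lookup-injective f (x ∷ xs) (fx∉ ∷ _)        (suc i) zero    eq = ⊥-elim (All.lookup fx∉ (∈-map⁺ f (∈-lookup i)) (sym eq))
lookup-injective f (x ∷ xs) (_ ∷ unique)     (suc i) (suc j) eq = cong suc (lookup-injective f xs unique i j eq)

realize : (l : List ℤ) {S : Subset n} → length l ≡ n → map ℤ.∣_∣ l ↭ range 0 n →
          (∀ z → Pinnacle l z ⇔ Encodes S z) →
          Σ (Word n) λ w → IsSignedPerm n w × HasPinnacleSet w S × (∀ i → w i ∈ l)
realize l {S} refl abs↭ pinnacles⇔ =
  lookup l , (inRange , lookup-injective ℤ.∣_∣ l unique) , hasPinnacleSet , ∈-lookup
  where
  inRange : ∀ i → 1 ≤ ℤ.∣ lookup l i ∣ × ℤ.∣ lookup l i ∣ ≤ length l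
  inRange i = ∈-range⁻ 0 (length l) (∈-resp-↭ abs↭ (∈-map⁺ ℤ.∣_∣ (∈-lookup i)))
  unique : Unique (map ℤ.∣_∣ l)
  unique = ↭ₛ.Unique-resp-↭ (setoid ℕ) (↭⇒↭ₛ (↭-sym abs↭)) (range-unique 0 (length l))
  hasPinnacleSet : HasPinnacleSet (lookup l) S
  hasPinnacleSet z = ⇔.trans (IsPinnacle⇔Pinnacle (lookup l) z)
                             (subst (λ l′ → Pinnacle l′ z ⇔ Encodes S z) (sym (tabulate-lookup l)) (pinnacles⇔ z))

map-inverse : {f : A → B} {g : B → A} → (∀ x → g (f x) ≡ x) → ∀ xs → map g (map f xs) ≡ xs
map-inverse g∘f≡id xs = trans (sym (map-∘ xs)) (trans (map-cong g∘f≡id xs) (map-id xs))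

zigzag-realizes : (S : Subset n) {vs : List ℤ} → Zigzag (map +_ (members 0 S)) vs → map ℤ.∣_∣ vs ≡ nonMembers 0 S →
                  Σ (Word n) λ w → IsSignedPerm n w × HasPinnacleSet w S × (∀ i → w i ∈ map +_ (members 0 S) ++ vs)
zigzag-realizes {n} S {vs} zz ∣vs∣≡ =
  let w , signed , hasPinnacleSet , w∈ = realize l length≡ abs↭ pinnacles⇔
  in  w , signed , hasPinnacleSet , λ i → ∈-resp-↭ (zigzag-↭ zz) (w∈ i)
  where
  ps = map +_ (members 0 S)
  l  = zigzag ps vs
  abs↭ : map ℤ.∣_∣ l ↭ range 0 n
  abs↭ = ↭-trans (↭.map⁺ ℤ.∣_∣ (zigzag-↭ zz))
          (↭-trans (↭-reflexive (trans (map-++ ℤ.∣_∣ ps vs) (cong₂ _++_ (map-inverse (λ _ → refl) (members 0 S)) ∣vs∣≡)))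
                   (members++nonMembers↭range 0 S))
  length≡ : length l ≡ n
  length≡ = trans (sym (length-map ℤ.∣_∣ l)) (trans (↭-length abs↭) (length-range 0 n))
  pinnacles⇔ : ∀ z → Pinnacle l z ⇔ Encodes S z
  pinnacles⇔ z = ⇔.trans (Pinnacle-zigzag⇔ zz z) (⇔.sym (Encodes⇔∈members S z))

-- Realizing small sets and ballot sets

negated : ℕ → ℤ
negated t = ℤ.- (+ t)

negated<+ : ∀ t {s} → 0 < s → negated t ℤ.< + s
negated<+ zero    0<s = +<+ 0<s
negated<+ (suc t) _   = ℤ.-<+

negatedZigzag : ∀ ps vs → All (0 <_) ps → Linked _<_ vs → length ps < length vs → Zigzag (map +_ ps) (map negated vs)
negatedZigzag []       (v ∷ vs)      _           vs↗       _         =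
  flat (↘⇒NoPinnacle (Linked.map⁺ (Linked.map (ℤ.neg-mono-< ∘ +<+) vs↗)))
negatedZigzag (p ∷ ps) (v ∷ v′ ∷ vs) (0<p ∷ 0<ps) (_ ∷ vs↗) (s≤s len<) =
  peak (negated<+ v 0<p) (negated<+ v′ 0<p) (negatedZigzag ps (v′ ∷ vs) 0<ps vs↗ len<)

Small⇒InAPS⁺ : (S : Subset n) → Small n S → InAPS⁺ n S
Small⇒InAPS⁺ {n} S small =
  let w , signed , hasPinnacleSet , _ =
        zigzag-realizes S (negatedZigzag (members 0 S) (nonMembers 0 S) (members-above 0 S) (nonMembers-↗ 0 S) fewer)
                          (map-inverse (ℤ.∣-i∣≡∣i∣ ∘ +_) (nonMembers 0 S))
  in  w , signed , hasPinnacleSet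
  where
  #members+#nonMembers : length (members 0 S) + length (nonMembers 0 S) ≡ n
  #members+#nonMembers = trans (sym (length-++ (members 0 S)))
                               (trans (↭-length (members++nonMembers↭range 0 S)) (length-range 0 n))
  fewer : length (members 0 S) < length (nonMembers 0 S)
  fewer = +-cancelˡ-< (length (members 0 S)) _ _
    (subst₂ _<_ (trans (double≡+ ∣ S ∣) (cong (λ k → k + k) (sym (length-members 0 S)))) (sym #members+#nonMembers) small)

data AscZigzag : List ℕ → List ℕ → Set where
  flat : ∀ {v vs} → Linked _<_ (v ∷ vs) → AscZigzag [] (v ∷ vs)
  peak : ∀ {p ps v v′ vs} → v < p → v′ < p → AscZigzag ps (v′ ∷ vs) → AscZigzag (p ∷ ps) (v ∷ v′ ∷ vs)

AscZigzag⇒Zigzag : ∀ {ps vs} → AscZigzag ps vs → Zigzag (map +_ ps) (map +_ vs)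
AscZigzag⇒Zigzag (flat vs↗)         = flat (↗⇒NoPinnacle (Linked.map⁺ (Linked.map +<+ vs↗)))
AscZigzag⇒Zigzag (peak v<p v′<p zz) = peak (+<+ v<p) (+<+ v′<p) (AscZigzag⇒Zigzag zz)

Linked-∷ʳ : ∀ {xs x} → Linked _<_ xs → All (_< x) xs → Linked _<_ (xs ++ [ x ])
Linked-∷ʳ []         []           = [-]
Linked-∷ʳ [-]        (y<x ∷ [])   = y<x ∷ [-]
Linked-∷ʳ (y<z ∷ xs↗) (_ ∷ xs<x)  = y<z ∷ Linked-∷ʳ xs↗ xs<x

AscZigzag-∷ʳ-valley : ∀ {ps vs x} → AscZigzag ps vs → All (_< x) vs → AscZigzag ps (vs ++ [ x ])
AscZigzag-∷ʳ-valley (flat vs↗)         vs<x       = flat (Linked-∷ʳ vs↗ vs<x)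
AscZigzag-∷ʳ-valley (peak v<p v′<p zz) (_ ∷ vs<x) = peak v<p v′<p (AscZigzag-∷ʳ-valley zz vs<x)

AscZigzag-∷ʳ-peak : ∀ {ps vs x} → AscZigzag ps vs → 2 + length ps ≤ length vs → All (_< x) vs →
                    AscZigzag (ps ++ [ x ]) vs
AscZigzag-∷ʳ-peak (flat {vs = _ ∷ _} vs↗) _         (v<x ∷ v′<x ∷ _) = peak v<x v′<x (flat (Linked.tail vs↗))
AscZigzag-∷ʳ-peak (flat {vs = []} _)      (s≤s ())  _
AscZigzag-∷ʳ-peak (peak v<p v′<p zz)      (s≤s len) (_ ∷ vs<x)       = peak v<p v′<p (AscZigzag-∷ʳ-peak zz len vs<x)

Ballot⇒AscZigzag : ∀ o h (S : Subset n) {ps vs} → AscZigzag ps vs → length vs ≡ length ps + h → All (_≤ o) vs →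
                   Ballot h S → AscZigzag (ps ++ members o S) (vs ++ nonMembers o S)
Ballot⇒AscZigzag o h [] {ps} {vs} zz _ _ _ rewrite ++-identityʳ ps | ++-identityʳ vs = zz
Ballot⇒AscZigzag o h (outside ∷ S) {ps} {vs} zz len vs≤o ballot
  rewrite sym (++-assoc vs [ suc o ] (nonMembers (suc o) S)) =
  Ballot⇒AscZigzag (suc o) (suc h) S (AscZigzag-∷ʳ-valley zz (All.map s≤s vs≤o))
    (trans (length-++ vs) (trans (cong (_+ 1) len) (+1-moves (length ps) h)))
    (All.++⁺ (All.map m≤n⇒m≤1+n vs≤o) (≤-refl ∷ [])) ballot
  where
  +1-moves : ∀ a h → a + h + 1 ≡ a + suc h
  +1-moves = solve-∀
Ballot⇒AscZigzag o (suc zero) (inside ∷ S) _ _ _ (s≤s () , _)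
Ballot⇒AscZigzag o (suc (suc h)) (inside ∷ S) {ps} {vs} zz len vs≤o (_ , ballot)
  rewrite sym (++-assoc ps [ suc o ] (members (suc o) S)) =
  Ballot⇒AscZigzag (suc o) (suc h) S (AscZigzag-∷ʳ-peak zz twoMore (All.map s≤s vs≤o))
    (trans len (trans (+1-moves (length ps) h) (cong (_+ suc h) (sym (length-++ ps)))))
    (All.map m≤n⇒m≤1+n vs≤o) ballot
  where
  twoMore : 2 + length ps ≤ length vs
  twoMore = subst (2 + length ps ≤_) (sym len)
    (≤-trans (≤-reflexive (+-comm 2 (length ps))) (+-monoʳ-≤ (length ps) (s≤s (s≤s z≤n))))
  +1-moves : ∀ a h → a + suc (suc h) ≡ a + 1 + suc h
  +1-moves = solve-∀

Ballot⇒InAPS : (S : Subset (suc n)) → Ballot 0 S → InAPS (suc n) S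
Ballot⇒InAPS (outside ∷ S) ballot =
  let w , signed , hasPinnacleSet , w∈ =
        zigzag-realizes (outside ∷ S) (AscZigzag⇒Zigzag zz) (map-inverse (λ _ → refl) (nonMembers 0 (outside ∷ S)))
  in  w , (signed , λ i → All.lookup positive (w∈ i)) , hasPinnacleSet
  where
  zz : AscZigzag (members 1 S) (1 ∷ nonMembers 1 S)
  zz = Ballot⇒AscZigzag 1 1 S (flat [-]) refl (≤-refl ∷ []) ballot
  positive : All (+ 0 ℤ.<_) (map +_ (members 1 S) ++ map +_ (1 ∷ nonMembers 1 S))
  positive = All.++⁺ (All.map⁺ (All.map +<+ (members-above 0 (outside ∷ S))))
                     (All.map⁺ (All.map +<+ (nonMembers-above 0 (outside ∷ S))))

-- Necessary conditions

Unique⇒length-mono-⊆ : {xs ys : List A} → Unique xs → (∀ {x} → x ∈ xs → x ∈ ys) → length xs ≤ length ys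
Unique⇒length-mono-⊆ {xs = []}     _              _     = z≤n
Unique⇒length-mono-⊆ {xs = x ∷ xs} (x∉xs ∷ unique) xs⊆ys with ∈-∃++ (xs⊆ys (here refl))
... | ys₁ , ys₂ , refl =
  ≤-trans (s≤s (Unique⇒length-mono-⊆ unique xs⊆ys₁++ys₂)) (≤-reflexive (sym (length-++-sucʳ ys₁ x ys₂)))
  where
  xs⊆ys₁++ys₂ : ∀ {y} → y ∈ xs → y ∈ ys₁ ++ ys₂
  xs⊆ys₁++ys₂ y∈xs with ∈-++⁻ ys₁ (xs⊆ys (there y∈xs))
  ... | inj₁ y∈ys₁         = ∈-++⁺ˡ y∈ys₁
  ... | inj₂ (here refl)   = ⊥-elim (All.lookup x∉xs y∈xs refl)
  ... | inj₂ (there y∈ys₂) = ∈-++⁺ʳ ys₁ y∈ys₂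

HasPinnacleSet⇒prefix-bound : {w : Word n} {S : Subset n} → HasPinnacleSet w S →
                              ∀ m → ∣ S ↾ m ∣ ≡ 0 ⊎ double ∣ S ↾ m ∣ < #≤ (+ m) (tabulate w)
HasPinnacleSet⇒prefix-bound {w = w} {S} hasPinnacleSet m = conclude (pinnacles-bound (+ m) (tabulate w))
  where
  P = #≤ (+ m) (pinnacles (tabulate w))
  Y = filter (_≤? m) (members 0 S)
  Y⊆pinnacles : ∀ {z} → z ∈ map +_ Y → z ∈ filter (ℤ._≤? + m) (pinnacles (tabulate w))
  Y⊆pinnacles z∈ with ∈-map⁻ +_ z∈
  ... | y , y∈Y , refl =
    let y∈members , y≤m = ∈-filter⁻ (_≤? m) y∈Y
        isPinnacle = Equivalence.from (hasPinnacleSet (+ y)) (Equivalence.from (Encodes⇔∈members S (+ y)) (∈-map⁺ +_ y∈members))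
    in  ∈-filter⁺ (ℤ._≤? + m) (∈-pinnacles⁺ (IsPinnacle⇒Pinnacle w isPinnacle)) (+≤+ y≤m)
  ∣S↾m∣≤P : ∣ S ↾ m ∣ ≤ P
  ∣S↾m∣≤P = begin
    ∣ S ↾ m ∣          ≡⟨ sym (length-filter-members 0 m S) ⟩
    length Y           ≡⟨ sym (length-map +_ Y) ⟩
    length (map +_ Y)  ≤⟨ Unique⇒length-mono-⊆ (Unique.map⁺ ℤ.+-injective (Unique.filter⁺ (_≤? m) (↗⇒Unique (members-↗ 0 S)))) Y⊆pinnacles ⟩
    P                  ∎
    where open ≤-Reasoning
  conclude : P ≡ 0 ⊎ double P < #≤ (+ m) (tabulate w) → ∣ S ↾ m ∣ ≡ 0 ⊎ double ∣ S ↾ m ∣ < #≤ (+ m) (tabulate w)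
  conclude (inj₁ P≡0) = inj₁ (n≤0⇒n≡0 (subst (∣ S ↾ m ∣ ≤_) P≡0 ∣S↾m∣≤P))
  conclude (inj₂ 2P<E) = inj₂ (≤-<-trans (double-mono-≤ ∣S↾m∣≤P) 2P<E)

InAPS⁺⇒Small : {S : Subset n} → 1 ≤ n → InAPS⁺ n S → Small n S
InAPS⁺⇒Small {n} {S} 1≤n (w , _ , hasPinnacleSet) = conclude (HasPinnacleSet⇒prefix-bound hasPinnacleSet n)
  where
  E≤n : #≤ (+ n) (tabulate w) ≤ n
  E≤n = ≤-trans (length-filter (ℤ._≤? + n) (tabulate w)) (≤-reflexive (length-tabulate w))
  conclude : ∣ S ↾ n ∣ ≡ 0 ⊎ double ∣ S ↾ n ∣ < #≤ (+ n) (tabulate w) → Small n S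
  conclude (inj₁ ≡0)  = subst (λ k → double k < n) (trans (sym ≡0) (∣S↾n∣≡∣S∣ S)) 1≤n
  conclude (inj₂ 2P<E) = subst (λ k → double k < n) (∣S↾n∣≡∣S∣ S) (<-≤-trans 2P<E E≤n)

InAPS⇒Ballot : {S : Subset n} → InAPS n S → Ballot 0 S
InAPS⇒Ballot {n} {S} (w , ((_ , injective) , positive) , hasPinnacleSet) =
  prefix⇒Ballot 0 S λ m 1≤m → conclude m 1≤m (HasPinnacleSet⇒prefix-bound hasPinnacleSet m)
  where
  E≤m : ∀ m → #≤ (+ m) (tabulate w) ≤ m
  E≤m m = ≤-trans (Unique⇒length-mono-⊆ unique ⊆range) (≤-reflexive (trans (length-map +_ (range 0 m)) (length-range 0 m)))
    where
    unique : Unique (filter (ℤ._≤? + m) (tabulate w))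
    unique = Unique.filter⁺ (ℤ._≤? + m) (Unique.tabulate⁺ (λ {i} {j} eq → injective i j (cong ℤ.∣_∣ eq)))
    ⊆range : ∀ {e} → e ∈ filter (ℤ._≤? + m) (tabulate w) → e ∈ map +_ (range 0 m)
    ⊆range e∈ with ∈-filter⁻ (ℤ._≤? + m) e∈
    ... | e∈w , e≤m with All.lookup (All.tabulate⁺ {P = + 0 ℤ.<_} positive) e∈w | e≤m
    ... | +<+ 0<k | +≤+ k≤m = ∈-map⁺ +_ (∈-range⁺ 0 m 0<k k≤m)
  conclude : ∀ m → 1 ≤ m → ∣ S ↾ m ∣ ≡ 0 ⊎ double ∣ S ↾ m ∣ < #≤ (+ m) (tabulate w) → double ∣ S ↾ m ∣ < m
  conclude m 1≤m (inj₁ ≡0)   = subst (λ k → double k < m) (sym ≡0) 1≤m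
  conclude m 1≤m (inj₂ 2P<E) = <-≤-trans 2P<E (E≤m m)

InDiff⇔Small×¬Ballot : (S : Subset (suc n)) → InDiff (suc n) S ⇔ (Small (suc n) S × ¬ Ballot 0 S)
InDiff⇔Small×¬Ballot S = mk⇔
  (λ (inAPS⁺ , ∉APS) → InAPS⁺⇒Small (s≤s z≤n) inAPS⁺ , ∉APS ∘ Ballot⇒InAPS S)
  (λ (small , ¬ballot) → Small⇒InAPS⁺ S small , ¬ballot ∘ InAPS⇒Ballot)

theorem4p12 : (k : ℕ) → 1 ≤ k →
    Σ (List (Subset (2 * k))) λ L →
      Unique L × (∀ S → S ∈ L ⇔ InDiff (2 * k) S) ×
      (length L ≡ 2 ^ (2 * k ∸ 1) ∸ (2 * k) C k)
theorem4p12 (suc j) _ = filter small∖ballot? (subsets N) , Unique.filter⁺ small∖ballot? (subsets-unique N) , ∈⇔ , count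
  where
  N = 2 * suc j
  small∖ballot? : Decidable (Small {N} N ∩ ∁ (Ballot 0))
  small∖ballot? = Small? N ∩? ∁? (Ballot? 0)
  ∈⇔ : ∀ S → S ∈ filter small∖ballot? (subsets N) ⇔ InDiff N S
  ∈⇔ S = ⇔.trans (mk⇔ (proj₂ ∘ ∈-filter⁻ small∖ballot? {xs = subsets N}) (∈-filter⁺ small∖ballot? (∈-subsets S)))
                 (⇔.sym (InDiff⇔Small×¬Ballot S))
  count : length (filter small∖ballot? (subsets N)) ≡ 2 ^ (N ∸ 1) ∸ N C suc j
  count = subst (λ N → #subsets (Small? {N} N ∩? ∁? (Ballot? 0)) ≡ 2 ^ (N ∸ 1) ∸ N C suc j)
                (trans (double≡+ (suc j)) (cong (_+_ (suc j)) (sym (+-identityʳ (suc j)))))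
                (#small∖ballot j)
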